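{- For every $n\ge 1$, \[\sum_{\sigma\in B_n} q^{\text{flag-major}_N(\sigma)}\,t^{\ell(\sigma)}=A_n(q^2,t)\prod_{i=1}^n(1+qt^i),\] where $A_n(q,t)=\sum_{\pi\in S_n} q^{maj(\pi)}t^{inv(\pi)}$.
   Context: $S_n$ is the symmetric group; for $\pi\in S_n$, $maj(\pi)=\sum\{i:\pi(i)>\pi(i+1)\}$ and $inv(\pi)=|\{i<j:\pi(i)>\pi(j)\}|$. $B_n$ is the group of bijections $\sigma$ of $[-n,n]\setminus\{0\}$ with $\sigma(-a)=-\sigma(a)$, written $\sigma=[\sigma(1),\dots,\sigma(n)]$. $N$ is the natural order $-n<\dots<-1<1<\dots<n$; $maj_N(\sigma)=\sum\{i\in[1,n-1]:\sigma(i)>\sigma(i+1)\}$; $neg(\sigma)=|\{i:\sigma(i)<0\}|$; $\text{flag-major}_N(\sigma)=2maj_N(\sigma)+neg(\sigma)$. $\ell(\sigma)$ is the Coxeter length w.r.t. $s_0=[-1,2,\dots,n]$ and the adjacent transpositions $s_i$, $1\le i\le n-1$; equivalently $\ell(\sigma)=|\{i<j:\sigma(i)>\sigma(j)\}|-\sum_{i:\sigma(i)<0}\sigma(i)$. -}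

module Defs where

open import Data.Nat using (ℕ; zero; suc) renaming (_+_ to _+ℕ_; _*_ to _*ℕ_)
open import Data.Integer using (ℤ; +_; -_; ∣_∣; _<?_; _≟_)
open import Data.Bool using (Bool; true; false; if_then_else_)
open import Data.List using (List; []; _∷_; map; filter; applyUpTo; _++_; concatMap; length)
open import Data.List.Relation.Unary.Unique.Propositional using (Unique)
open import Data.List.Relation.Unary.Unique.DecPropositional _≟_ using (unique?)
open import Relation.Nullary.Decidable using (does)
open import Algebra.Bundles using (CommutativeSemiring)
open import Level using (Level)

-- Permutations are represented by their one-line notation [w(1),...,w(n)],
-- a list of integers.  Values compare in the natural order of ℤ, which on
-- [-n,n]\{0} is exactly the order N : -n < ... < -1 < 1 < ... < n.

words : List ℤ → ℕ → List (List ℤ)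
words A zero    = [] ∷ []
words A (suc k) = concatMap (λ a → map (a ∷_) (words A k)) A

posVals : ℕ → List ℤ
posVals n = applyUpTo (λ i → + suc i) n

signedVals : ℕ → List ℤ
signedVals n = map -_ (posVals n) ++ posVals n

Sym : ℕ → List (List ℤ)
Sym n = filter (λ w → unique? w) (words (posVals n) n)

-- B_n : σ is determined by [σ(1),...,σ(n)]; σ is a bijection of [-n,n]\{0}
-- commuting with negation iff the values |σ(1)|,...,|σ(n)| are distinct.
Hyp : ℕ → List (List ℤ)
Hyp n = filter (λ w → unique? (map (λ x → + ∣ x ∣) w)) (words (signedVals n) n)

gt : ℤ → ℤ → Bool
gt x y = does (y <? x)

majFrom : ℕ → List ℤ → ℕ
majFrom i []           = 0
majFrom i (x ∷ [])     = 0
majFrom i (x ∷ y ∷ ws) = (if gt x y then i else 0) +ℕ majFrom (suc i) (y ∷ ws)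

maj : List ℤ → ℕ
maj = majFrom 1

inv : List ℤ → ℕ
inv []       = 0
inv (x ∷ ws) = length (filter (λ y → y <? x) ws) +ℕ inv ws

isNeg : ℤ → Bool
isNeg x = does (x <? + 0)

neg : List ℤ → ℕ
neg []       = 0
neg (x ∷ ws) = (if isNeg x then 1 else 0) +ℕ neg ws

negSum : List ℤ → ℕ
negSum []       = 0
negSum (x ∷ ws) = (if isNeg x then ∣ x ∣ else 0) +ℕ negSum ws

flagMajor : List ℤ → ℕ
flagMajor w = 2 *ℕ maj w +ℕ neg w

-- Coxeter length of B_n (combinatorial formula from the paper's context)
lengthB : List ℤ → ℕ
lengthB w = inv w +ℕ negSum w

module Poly {c ℓ : Level} (R : CommutativeSemiring c ℓ) where
  open CommutativeSemiring R

  pow : Carrier → ℕ → Carrier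
  pow x zero    = 1#
  pow x (suc k) = x * pow x k

  sumL : List Carrier → Carrier
  sumL []       = 0#
  sumL (x ∷ xs) = x + sumL xs

  A : ℕ → Carrier → Carrier → Carrier
  A n q t = sumL (map (λ π → pow q (maj π) * pow t (inv π)) (Sym n))

  B : ℕ → Carrier → Carrier → Carrier
  B n q t = sumL (map (λ σ → pow q (flagMajor σ) * pow t (lengthB σ)) (Hyp n))

  prodFactor : ℕ → Carrier → Carrier → Carrier
  prodFactor zero    q t = 1#
  prodFactor (suc k) q t = prodFactor k q t * (1# + q * pow t (suc k))

-- A signed permutation σ ∈ B_n amounts to its value set C = {σ(1),…,σ(n)}, which
-- contains exactly one of ±i for every i ∈ [1,n], together with an arrangement of C.
-- On the arrangements of a fixed C, neg and the sum of negated absolute values are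
-- constant, namely |S| and ΣS for the set S of those i with -i ∈ C, while maj and inv
-- are those of the permutation in S_n obtained by replacing every value by its rank
-- in C, since ranking preserves the order N.  So C contributes A_n(q², t) q^|S| t^ΣS,
-- and summing over all 2^n sets S gives A_n(q², t) ∏(1 + q t^i).
module Submission where

open import Defs
open import Data.Nat using (ℕ; _≥_)
open import Algebra.Bundles using (CommutativeSemiring)
open import Level using (Level)

open import Level using (_⊔_)
open import Data.Nat as ℕ using (zero; suc; _≤_; _<_; z≤n; s≤s)
import Data.Nat.Properties as ℕ
open import Data.Nat.ListAction using (sum)
open import Data.Nat.ListAction.Properties using (sum-↭)
open import Data.Integer as ℤ using (ℤ; +_; -_; -[1+_]; ∣_∣; _<?_; _≟_)
import Data.Integer.Properties as ℤ
open import Data.Bool using (true; false; if_then_else_)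
open import Data.Product using (∃-syntax; _×_; _,_; proj₁; proj₂)
open import Data.Sum using (_⊎_; inj₁; inj₂; [_,_])
open import Function using (id; _∘_; mk⇔)
open import Relation.Nullary using (¬_; yes; no; does; contradiction)
open import Relation.Nullary.Decidable using (dec-true; dec-false)
open import Relation.Unary using (Pred; Decidable)
open import Relation.Binary.Definitions using (DecidableEquality; tri<; tri≈; tri>)
open import Relation.Binary.PropositionalEquality
  using (_≡_; _≢_; refl; sym; trans; cong; cong₂; subst)
open import Data.List using (List; []; _∷_; map; _++_; concatMap; length; filter)
import Data.List.Properties as List
open import Data.List.Membership.Propositional using (_∈_; _∉_; find)
open import Data.List.Membership.Propositional.Properties
  using (∈-map⁺; ∈-map⁻; ∈-++⁺ˡ; ∈-++⁺ʳ; ∈-++⁻; ∈-∃++; ∈-concat⁺′; ∈-concatMap⁻;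
         ∈-filter⁺; ∈-filter⁻; ∈-applyUpTo⁺; ∈-applyUpTo⁻)
open import Data.List.Membership.Propositional.Properties.WithK using (unique∧set⇒bag)
import Data.List.Membership.DecPropositional as DecMembership
open import Data.List.Relation.Binary.Subset.Propositional using (_⊆_)
open import Data.List.Relation.Unary.Any as Any using (here; there)
open import Data.List.Relation.Unary.All as All using (All; []; _∷_)
import Data.List.Relation.Unary.All.Properties as Allₚ
open import Data.List.Relation.Unary.AllPairs using ([]; _∷_)
open import Data.List.Relation.Unary.Unique.Propositional using (Unique)
import Data.List.Relation.Unary.Unique.Propositional.Properties as Unique
open import Data.List.Relation.Unary.Unique.DecPropositional _≟_ using (unique?)
open DecMembership _≟_ using (_∈?_)
import Data.List.Relation.Binary.Permutation.Propositional as ↭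
open ↭ using (_↭_; ↭-sym)
open import Data.List.Relation.Binary.Permutation.Propositional.Properties
  using (∈-resp-↭; shift; ↭-length) renaming (map⁺ to ↭-map⁺)
open import Data.List.Relation.Binary.BagAndSetEquality using (∼bag⇒↭)
import Algebra.Properties.CommutativeSemigroup as CommutativeSemigroupProperties
import Algebra.Properties.CommutativeSemiring.Exp as ExpProperties
import Relation.Binary.Reasoning.Setoid as SetoidReasoning

module _ {a} {A : Set a} where

  unique∧⊆∧⊇⇒↭ : {xs ys : List A} → Unique xs → Unique ys → xs ⊆ ys → ys ⊆ xs →
                 xs ↭ ys
  unique∧⊆∧⊇⇒↭ u v xs⊆ys ys⊆xs = ∼bag⇒↭ (unique∧set⇒bag u v (mk⇔ xs⊆ys ys⊆xs))

  unique∧⊆⇒length≤ : {xs ys : List A} → Unique xs → xs ⊆ ys → length xs ≤ length ys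
  unique∧⊆⇒length≤ [] _ = z≤n
  unique∧⊆⇒length≤ {x ∷ xs} (x≢xs ∷ u) x∷xs⊆ys
    with as , bs , refl ← ∈-∃++ (x∷xs⊆ys (here refl)) =
    ℕ.≤-trans (s≤s (unique∧⊆⇒length≤ u xs⊆as++bs))
              (ℕ.≤-reflexive (sym (↭-length (shift x as bs))))
    where
    xs⊆as++bs : xs ⊆ as ++ bs
    xs⊆as++bs z∈xs with ∈-++⁻ as (x∷xs⊆ys (there z∈xs))
    ... | inj₁ z∈as         = ∈-++⁺ˡ z∈as
    ... | inj₂ (here refl)  = contradiction refl (All.lookup x≢xs z∈xs)
    ... | inj₂ (there z∈bs) = ∈-++⁺ʳ as z∈bs

  module _ (_≟ᴬ_ : DecidableEquality A) where
    open DecMembership _≟ᴬ_ using () renaming (_∈?_ to _∈ᴬ?_)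

    pigeonhole : {xs ys : List A} → Unique xs → xs ⊆ ys → length ys ≤ length xs → ys ⊆ xs
    pigeonhole {xs} {ys} u xs⊆ys |ys|≤|xs| {y} y∈ys with y ∈ᴬ? xs
    ... | yes y∈xs = y∈xs
    ... | no  y∉xs =
      contradiction |ys|≤|xs| (ℕ.<⇒≱ (unique∧⊆⇒length≤ (y≢xs ∷ u) y∷xs⊆ys))
      where
      y≢xs : All (y ≢_) xs
      y≢xs = All.tabulate λ { z∈xs refl → y∉xs z∈xs }
      y∷xs⊆ys : y ∷ xs ⊆ ys
      y∷xs⊆ys (here refl)  = y∈ys
      y∷xs⊆ys (there z∈xs) = xs⊆ys z∈xs

    unique∧⊆∧length⇒↭ : {xs ys : List A} → Unique xs → Unique ys → xs ⊆ ys →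
                        length ys ≤ length xs → xs ↭ ys
    unique∧⊆∧length⇒↭ u v xs⊆ys len = unique∧⊆∧⊇⇒↭ u v xs⊆ys (pigeonhole u xs⊆ys len)

module _ {a b} {A : Set a} {B : Set b} where

  InjectiveOn : (A → B) → List A → Set (a ⊔ b)
  InjectiveOn f xs = ∀ {x y} → x ∈ xs → y ∈ xs → f x ≡ f y → x ≡ y

  injectiveOn-⊆ : ∀ {f : A → B} {xs ys} → InjectiveOn f ys → xs ⊆ ys → InjectiveOn f xs
  injectiveOn-⊆ inj xs⊆ys x∈ y∈ = inj (xs⊆ys x∈) (xs⊆ys y∈)

  map⁺-injectiveOn : ∀ {f : A → B} {xs} → InjectiveOn f xs → Unique xs → Unique (map f xs)
  map⁺-injectiveOn {xs = []} inj [] = []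
  map⁺-injectiveOn {f} {x ∷ xs} inj (x≢xs ∷ u) =
    Allₚ.map⁺ (All.tabulate fx≢fy) ∷ map⁺-injectiveOn (λ p q → inj (there p) (there q)) u
    where
    fx≢fy : ∀ {y} → y ∈ xs → f x ≢ f y
    fx≢fy y∈xs = All.lookup x≢xs y∈xs ∘ inj (here refl) (there y∈xs)

  map⁻-injectiveOn : ∀ {f : A → B} {xs} → Unique (map f xs) → InjectiveOn f xs
  map⁻-injectiveOn (_ ∷ _) (here refl) (here refl) _ = refl
  map⁻-injectiveOn {f} (fx≢ ∷ _) (here refl) (there y∈) fx≡fy =
    contradiction fx≡fy (All.lookup fx≢ (∈-map⁺ f y∈))
  map⁻-injectiveOn {f} (fy≢ ∷ _) (there x∈) (here refl) fx≡fy =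
    contradiction (sym fx≡fy) (All.lookup fy≢ (∈-map⁺ f x∈))
  map⁻-injectiveOn (_ ∷ u) (there x∈) (there y∈) fx≡fy = map⁻-injectiveOn u x∈ y∈ fx≡fy

  map-injectiveOn : ∀ {f : A → B} {zs xs ys} → InjectiveOn f zs → xs ⊆ zs → ys ⊆ zs →
                    map f xs ≡ map f ys → xs ≡ ys
  map-injectiveOn {xs = []}     {[]}     _   _     _     _  = refl
  map-injectiveOn {xs = x ∷ xs} {y ∷ ys} inj xs⊆zs ys⊆zs eq =
    cong₂ _∷_ (inj (xs⊆zs (here refl)) (ys⊆zs (here refl)) (List.∷-injectiveˡ eq))
              (map-injectiveOn inj (xs⊆zs ∘ there) (ys⊆zs ∘ there) (List.∷-injectiveʳ eq))

  ⊆-map⁻ : ∀ {f : A → B} {xs ys} → ys ⊆ map f xs → ∃[ zs ] zs ⊆ xs × map f zs ≡ ys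
  ⊆-map⁻ {ys = []} _ = [] , (λ ()) , refl
  ⊆-map⁻ {f} {ys = y ∷ ys} y∷ys⊆
    with x , x∈xs , refl ← ∈-map⁻ f (y∷ys⊆ (here refl))
       | zs , zs⊆xs , refl ← ⊆-map⁻ (y∷ys⊆ ∘ there) =
    x ∷ zs , (λ { (here refl) → x∈xs ; (there z∈zs) → zs⊆xs z∈zs }) , refl

  filter-map-on : ∀ {p q} {P : Pred B p} {Q : Pred A q} (P? : Decidable P) (Q? : Decidable Q)
                  {f : A → B} {xs} → (∀ {x} → x ∈ xs → does (P? (f x)) ≡ does (Q? x)) →
                  filter P? (map f xs) ≡ map f (filter Q? xs)
  filter-map-on P? Q? {xs = []} _ = refl
  filter-map-on P? Q? {f} {x ∷ xs} agree with does (P? (f x)) | does (Q? x) | agree (here refl)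
  ... | true  | true  | _ = cong (f x ∷_) (filter-map-on P? Q? (agree ∘ there))
  ... | false | false | _ = filter-map-on P? Q? (agree ∘ there)
  ... | true  | false | ()
  ... | false | true  | ()

  unique-concatMap : ∀ {F : A → List B} {xs} → Unique xs → (∀ {x} → x ∈ xs → Unique (F x)) →
                     (∀ {x y z} → x ∈ xs → y ∈ xs → z ∈ F x → z ∈ F y → x ≡ y) →
                     Unique (concatMap F xs)
  unique-concatMap {xs = []} _ _ _ = []
  unique-concatMap {F} {x ∷ xs} (x≢xs ∷ u) uF disjoint =
    Unique.++⁺ (uF (here refl))
               (unique-concatMap u (uF ∘ there) (λ x∈ y∈ → disjoint (there x∈) (there y∈)))
               λ (z∈Fx , z∈rest) →
                 let y , y∈xs , z∈Fy = find (∈-concatMap⁻ F {xs = xs} z∈rest) in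
                 All.lookup x≢xs y∈xs (disjoint (here refl) (there y∈xs) z∈Fx z∈Fy)

module _ {a p q} {A : Set a} {P : Pred A p} {Q : Pred A q} (P? : Decidable P) (Q? : Decidable Q)
         (P⇒Q : ∀ {x} → P x → Q x) where

  length-filter-mono : ∀ xs → length (filter P? xs) ≤ length (filter Q? xs)
  length-filter-mono []       = z≤n
  length-filter-mono (y ∷ xs) with P? y | Q? y
  ... | yes _  | yes _  = s≤s (length-filter-mono xs)
  ... | no _   | yes _  = ℕ.m≤n⇒m≤1+n (length-filter-mono xs)
  ... | no _   | no _   = length-filter-mono xs
  ... | yes py | no ¬qy = contradiction (P⇒Q py) ¬qy

  length-filter-< : ∀ {x xs} → x ∈ xs → ¬ P x → Q x →
                    length (filter P? xs) < length (filter Q? xs)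
  length-filter-< {xs = y ∷ xs} (here refl) ¬py qy with P? y | Q? y
  ... | yes py | _      = contradiction py ¬py
  ... | no _   | yes _  = s≤s (length-filter-mono xs)
  ... | no _   | no ¬qy = contradiction qy ¬qy
  length-filter-< {xs = y ∷ xs} (there x∈xs) ¬px qx with P? y | Q? y
  ... | yes _  | yes _  = s≤s (length-filter-< x∈xs ¬px qx)
  ... | no _   | yes _  = ℕ.m≤n⇒m≤1+n (length-filter-< x∈xs ¬px qx)
  ... | no _   | no _   = length-filter-< x∈xs ¬px qx
  ... | yes py | no ¬qy = contradiction (P⇒Q py) ¬qy

∈-words⁻ : ∀ A k {w} → w ∈ words A k → length w ≡ k × w ⊆ A
∈-words⁻ A zero    (here refl) = refl , λ ()
∈-words⁻ A (suc k) w∈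
  with a , a∈A , w∈aW ← find (∈-concatMap⁻ (λ a → map (a ∷_) (words A k)) {xs = A} w∈)
  with v , v∈W , refl ← ∈-map⁻ (a ∷_) w∈aW
  with |v|≡k , v⊆A ← ∈-words⁻ A k v∈W =
  cong suc |v|≡k , λ { (here refl) → a∈A ; (there x∈v) → v⊆A x∈v }

∈-words⁺ : ∀ A {w} → w ⊆ A → w ∈ words A (length w)
∈-words⁺ A {[]}    _     = here refl
∈-words⁺ A {a ∷ w} a∷w⊆A =
  ∈-concat⁺′ (∈-map⁺ (a ∷_) (∈-words⁺ A (a∷w⊆A ∘ there))) (∈-map⁺ _ (a∷w⊆A (here refl)))

words-unique : ∀ {A} → Unique A → ∀ k → Unique (words A k)
words-unique u zero        = [] ∷ []
words-unique {A} u (suc k) =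
  unique-concatMap u (λ _ → Unique.map⁺ List.∷-injectiveʳ (words-unique u k)) same-head
  where
  same-head : ∀ {a b w} → a ∈ A → b ∈ A →
              w ∈ map (a ∷_) (words A k) → w ∈ map (b ∷_) (words A k) → a ≡ b
  same-head _ _ w∈aW w∈bW with _ , _ , refl ← ∈-map⁻ _ w∈aW | _ , _ , eq ← ∈-map⁻ _ w∈bW =
    List.∷-injectiveˡ eq

arrangements : List ℤ → ℕ → List (List ℤ)
arrangements A k = filter (λ w → unique? w) (words A k)

∈-arrangements⁻ : ∀ {A} k {w} → w ∈ arrangements A k → length w ≡ k × w ⊆ A × Unique w
∈-arrangements⁻ {A} k w∈ with w∈W , uw ← ∈-filter⁻ (λ w → unique? w) {xs = words A k} w∈ =
  let |w|≡k , w⊆A = ∈-words⁻ A k w∈W in |w|≡k , w⊆A , uw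

∈-arrangements⇒⊆ : ∀ {A} k {w} → w ∈ arrangements A k → w ⊆ A
∈-arrangements⇒⊆ k = proj₁ ∘ proj₂ ∘ ∈-arrangements⁻ k

∈-arrangements⁺ : ∀ {A k w} → length w ≡ k → w ⊆ A → Unique w → w ∈ arrangements A k
∈-arrangements⁺ {A} refl w⊆A uw = ∈-filter⁺ (λ w → unique? w) (∈-words⁺ A w⊆A) uw

arrangements-unique : ∀ {A} → Unique A → ∀ k → Unique (arrangements A k)
arrangements-unique u k = Unique.filter⁺ (λ w → unique? w) (words-unique u k)

∈-arrangements⇒↭ : ∀ {A k w} → Unique A → length A ≡ k → w ∈ arrangements A k → w ↭ A
∈-arrangements⇒↭ {k = k} uA refl w∈ with |w|≡|A| , w⊆A , uw ← ∈-arrangements⁻ k w∈ =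
  unique∧⊆∧length⇒↭ _≟_ uw uA w⊆A (ℕ.≤-reflexive (sym |w|≡|A|))

arrangements-map-↭ : ∀ {f A B} → Unique A → Unique B → (∀ {x} → x ∈ A → f x ∈ B) →
                     InjectiveOn f A → length B ≤ length A →
                     ∀ k → map (map f) (arrangements A k) ↭ arrangements B k
arrangements-map-↭ {f} {A} {B} uA uB f[A]⊆B inj |B|≤|A| k =
  unique∧⊆∧⊇⇒↭ (map⁺-injectiveOn map-f-inj (arrangements-unique uA k))
               (arrangements-unique uB k) image⊆ ⊆image
  where
  map-f-inj : InjectiveOn (map f) (arrangements A k)
  map-f-inj v∈ w∈ = map-injectiveOn inj (∈-arrangements⇒⊆ k v∈) (∈-arrangements⇒⊆ k w∈)

  map-⊆ : ∀ {w} → w ⊆ A → map f w ⊆ B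
  map-⊆ w⊆A y∈ with _ , x∈w , refl ← ∈-map⁻ f y∈ = f[A]⊆B (w⊆A x∈w)

  B⊆f[A] : B ⊆ map f A
  B⊆f[A] = pigeonhole _≟_ (map⁺-injectiveOn inj uA) (map-⊆ id)
                      (subst (length B ≤_) (sym (List.length-map f A)) |B|≤|A|)

  image⊆ : map (map f) (arrangements A k) ⊆ arrangements B k
  image⊆ v∈ with w , w∈ , refl ← ∈-map⁻ (map f) v∈
            with |w|≡k , w⊆A , uw ← ∈-arrangements⁻ k w∈ =
    ∈-arrangements⁺ (trans (List.length-map f w) |w|≡k) (map-⊆ w⊆A)
                    (map⁺-injectiveOn (injectiveOn-⊆ inj w⊆A) uw)

  ⊆image : arrangements B k ⊆ map (map f) (arrangements A k)
  ⊆image π∈ with |π|≡k , π⊆B , uπ ← ∈-arrangements⁻ k π∈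
            with w , w⊆A , refl ← ⊆-map⁻ (B⊆f[A] ∘ π⊆B) =
    ∈-map⁺ (map f) (∈-arrangements⁺ (trans (sym (List.length-map f w)) |π|≡k) w⊆A (Unique.map⁻ uπ))

StrictlyMonotoneOn : (ℤ → ℤ) → List ℤ → Set
StrictlyMonotoneOn f A = ∀ {x y} → x ∈ A → y ∈ A → x ℤ.< y → f x ℤ.< f y

module _ {f A} (mono : StrictlyMonotoneOn f A) where

  strictlyMonotoneOn⇒injectiveOn : InjectiveOn f A
  strictlyMonotoneOn⇒injectiveOn {x} {y} x∈ y∈ fx≡fy with ℤ.<-cmp x y
  ... | tri< x<y _ _ = contradiction fx≡fy (ℤ.<⇒≢ (mono x∈ y∈ x<y))
  ... | tri≈ _ x≡y _ = x≡y
  ... | tri> _ _ y<x = contradiction (sym fx≡fy) (ℤ.<⇒≢ (mono y∈ x∈ y<x))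

  gt-preserved : ∀ {x y} → x ∈ A → y ∈ A → gt (f x) (f y) ≡ gt x y
  gt-preserved {x} {y} x∈ y∈ with ℤ.<-cmp x y
  ... | tri< x<y _ _  = trans (dec-false (f y <? f x) (ℤ.<-asym (mono x∈ y∈ x<y)))
                              (sym (dec-false (y <? x) (ℤ.<-asym x<y)))
  ... | tri≈ _ refl _ = trans (dec-false (f y <? f x) (ℤ.<-irrefl refl))
                              (sym (dec-false (y <? x) (ℤ.<-irrefl refl)))
  ... | tri> _ _ y<x  = trans (dec-true (f y <? f x) (mono y∈ x∈ y<x))
                              (sym (dec-true (y <? x) y<x))

  majFrom-map : ∀ i {w} → w ⊆ A → majFrom i (map f w) ≡ majFrom i w
  majFrom-map i {[]}        _   = refl
  majFrom-map i {x ∷ []}    _   = refl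
  majFrom-map i {x ∷ y ∷ w} w⊆A =
    cong₂ ℕ._+_ (cong (λ b → if b then i else 0)
                      (gt-preserved (w⊆A (here refl)) (w⊆A (there (here refl)))))
                (majFrom-map (suc i) (w⊆A ∘ there))

  inv-map : ∀ {w} → w ⊆ A → inv (map f w) ≡ inv w
  inv-map {[]}    _   = refl
  inv-map {x ∷ w} w⊆A = cong₂ ℕ._+_ below-x≡ (inv-map (w⊆A ∘ there))
    where
    below-x≡ : length (filter (_<? f x) (map f w)) ≡ length (filter (_<? x) w)
    below-x≡ = trans (cong length (filter-map-on (_<? f x) (_<? x) λ y∈w →
                                     gt-preserved (w⊆A (here refl)) (w⊆A (there y∈w))))
                     (List.length-map f (filter (_<? x) w))

posVals-unique : ∀ n → Unique (posVals n)
posVals-unique n =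
  Unique.applyUpTo⁺₁ (λ i → + suc i) n λ i<j _ → ℕ.<⇒≢ i<j ∘ ℕ.suc-injective ∘ ℤ.+-injective

rank : List ℤ → ℤ → ℤ
rank A x = + suc (length (filter (_<? x) A))

rank-strictlyMonotoneOn : ∀ A → StrictlyMonotoneOn (rank A) A
rank-strictlyMonotoneOn A {x} {y} x∈A _ x<y =
  ℤ.+<+ (s≤s (length-filter-< (_<? x) (_<? y) (λ z<x → ℤ.<-trans z<x x<y)
                                x∈A (ℤ.<-irrefl refl) x<y))

rank-∈ : ∀ {A x} → x ∈ A → rank A x ∈ posVals (length A)
rank-∈ {A} {x} x∈A = ∈-applyUpTo⁺ (λ i → + suc i)
  (List.filter-notAll (_<? x) A (Any.map (λ { refl → ℤ.<-irrefl refl }) x∈A))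

arrangements-standardise : ∀ {A} → Unique A →
                           map (map (rank A)) (arrangements A (length A)) ↭ Sym (length A)
arrangements-standardise {A} uA =
  arrangements-map-↭ uA (posVals-unique (length A)) rank-∈
    (strictlyMonotoneOn⇒injectiveOn (rank-strictlyMonotoneOn A))
    (ℕ.≤-reflexive (List.length-applyUpTo (λ i → + suc i) (length A))) (length A)

absℤ : ℤ → ℤ
absℤ x = + ∣ x ∣

∣∣≡suc⇒± : ∀ {x k} → ∣ x ∣ ≡ suc k → x ≡ + suc k ⊎ x ≡ -[1+ k ]
∣∣≡suc⇒± {x = + _}      refl = inj₁ refl
∣∣≡suc⇒± {x = -[1+ _ ]} refl = inj₂ refl

∈-signedVals⁻ : ∀ {k x} → x ∈ signedVals k → ∃[ j ] j < k × ∣ x ∣ ≡ suc j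
∈-signedVals⁻ {k} x∈ with ∈-++⁻ (map -_ (posVals k)) x∈
... | inj₂ x∈pos with j , j<k , refl ← ∈-applyUpTo⁻ _ x∈pos = j , j<k , refl
∈-signedVals⁻ {k} x∈ | inj₁ x∈neg
  with _ , y∈pos , refl ← ∈-map⁻ -_ x∈neg
  with j , j<k , refl ← ∈-applyUpTo⁻ _ y∈pos = j , j<k , refl

∈-signedVals⁺ : ∀ {k x j} → j < k → ∣ x ∣ ≡ suc j → x ∈ signedVals k
∈-signedVals⁺ {k} {x} j<k |x|≡1+j with ∣∣≡suc⇒± {x} |x|≡1+j
... | inj₁ refl = ∈-++⁺ʳ (map -_ (posVals k)) (∈-applyUpTo⁺ (λ i → + suc i) j<k)
... | inj₂ refl = ∈-++⁺ˡ (∈-map⁺ -_ (∈-applyUpTo⁺ (λ i → + suc i) j<k))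

∈-signedVals-suc⁻ : ∀ {k x} → x ∈ signedVals (suc k) → x ∈ signedVals k ⊎ ∣ x ∣ ≡ suc k
∈-signedVals-suc⁻ x∈ with j , j<1+k , |x|≡1+j ← ∈-signedVals⁻ x∈
                     with ℕ.m<1+n⇒m<n∨m≡n j<1+k
... | inj₁ j<k  = inj₁ (∈-signedVals⁺ j<k |x|≡1+j)
... | inj₂ refl = inj₂ |x|≡1+j

signedVals-⊆-suc : ∀ {k} → signedVals k ⊆ signedVals (suc k)
signedVals-⊆-suc x∈ with j , j<k , |x|≡1+j ← ∈-signedVals⁻ x∈ =
  ∈-signedVals⁺ (ℕ.m<n⇒m<1+n j<k) |x|≡1+j

∉-signedVals : ∀ {k x} → ∣ x ∣ ≡ suc k → x ∉ signedVals k
∉-signedVals |x|≡1+k x∈ with j , j<k , |x|≡1+j ← ∈-signedVals⁻ x∈ =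
  ℕ.<-irrefl (ℕ.suc-injective (trans (sym |x|≡1+j) |x|≡1+k)) j<k

signedVals-unique : ∀ k → Unique (signedVals k)
signedVals-unique k =
  Unique.++⁺ (Unique.map⁺ ℤ.neg-injective (posVals-unique k)) (posVals-unique k)
             λ (x∈neg , x∈pos) → neg∉pos x∈neg x∈pos
  where
  neg∉pos : ∀ {x} → x ∈ map -_ (posVals k) → x ∉ posVals k
  neg∉pos x∈neg x∈pos
    with _ , y∈pos , refl ← ∈-map⁻ -_ x∈neg
    with _ , _ , refl ← ∈-applyUpTo⁻ _ y∈pos
    with _ , _ , () ← ∈-applyUpTo⁻ _ x∈pos

-- The value sets {σ(1),…,σ(k)} of the σ ∈ B_k, listed by decreasing absolute value.
data SignedSet : ℕ → List ℤ → Set where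
  []  : SignedSet 0 []
  _∷_ : ∀ {k x C} → ∣ x ∣ ≡ suc k → SignedSet k C → SignedSet (suc k) (x ∷ C)

signedSets : ℕ → List (List ℤ)
signedSets zero    = [] ∷ []
signedSets (suc k) = map (+ suc k ∷_) (signedSets k) ++ map (-[1+ k ] ∷_) (signedSets k)

∈-signedSets⁺ : ∀ {k C} → SignedSet k C → C ∈ signedSets k
∈-signedSets⁺ [] = here refl
∈-signedSets⁺ {suc k} {x ∷ C} (|x|≡1+k ∷ s) with ∣∣≡suc⇒± {x} |x|≡1+k
... | inj₁ refl = ∈-++⁺ˡ (∈-map⁺ (x ∷_) (∈-signedSets⁺ s))
... | inj₂ refl = ∈-++⁺ʳ (map (+ suc k ∷_) (signedSets k)) (∈-map⁺ (x ∷_) (∈-signedSets⁺ s))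

∈-signedSets⁻ : ∀ k {C} → C ∈ signedSets k → SignedSet k C
∈-signedSets⁻ zero (here refl) = []
∈-signedSets⁻ (suc k) C∈ with ∈-++⁻ (map (+ suc k ∷_) (signedSets k)) C∈
... | inj₁ C∈pos with _ , D∈ , refl ← ∈-map⁻ _ C∈pos = refl ∷ ∈-signedSets⁻ k D∈
... | inj₂ C∈neg with _ , D∈ , refl ← ∈-map⁻ _ C∈neg = refl ∷ ∈-signedSets⁻ k D∈

signedSets-unique : ∀ k → Unique (signedSets k)
signedSets-unique zero    = [] ∷ []
signedSets-unique (suc k) = Unique.++⁺ (prepend (+ suc k)) (prepend -[1+ k ])
                                       λ (C∈pos , C∈neg) → pos∉neg C∈pos C∈neg
  where
  prepend : ∀ x → Unique (map (x ∷_) (signedSets k))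
  prepend x = Unique.map⁺ List.∷-injectiveʳ (signedSets-unique k)
  pos∉neg : ∀ {C} → C ∈ map (+ suc k ∷_) (signedSets k) → C ∉ map (-[1+ k ] ∷_) (signedSets k)
  pos∉neg C∈pos C∈neg with _ , _ , refl ← ∈-map⁻ _ C∈pos with _ , _ , () ← ∈-map⁻ _ C∈neg

SignedSet-length : ∀ {k C} → SignedSet k C → length C ≡ k
SignedSet-length []      = refl
SignedSet-length (_ ∷ s) = cong suc (SignedSet-length s)

SignedSet-⊆ : ∀ {k C} → SignedSet k C → C ⊆ signedVals k
SignedSet-⊆ (|x|≡1+k ∷ s) (here refl)  = ∈-signedVals⁺ (ℕ.n<1+n _) |x|≡1+k
SignedSet-⊆ (_ ∷ s)       (there y∈C) = signedVals-⊆-suc (SignedSet-⊆ s y∈C)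

SignedSet-∉ : ∀ {k C x} → SignedSet k C → ∣ x ∣ ≡ suc k → x ∉ C
SignedSet-∉ s |x|≡1+k = ∉-signedVals |x|≡1+k ∘ SignedSet-⊆ s

SignedSet-absUnique : ∀ {k C} → SignedSet k C → Unique (map absℤ C)
SignedSet-absUnique []                        = []
SignedSet-absUnique {C = x ∷ C} (|x|≡1+k ∷ s) = All.tabulate |x|≢ ∷ SignedSet-absUnique s
  where
  |x|≢ : ∀ {z} → z ∈ map absℤ C → absℤ x ≢ z
  |x|≢ z∈ |x|≡z with y , y∈C , refl ← ∈-map⁻ absℤ z∈ =
    SignedSet-∉ s (trans (sym (ℤ.+-injective |x|≡z)) |x|≡1+k) y∈C

SignedSet-unique : ∀ {k C} → SignedSet k C → Unique C
SignedSet-unique = Unique.map⁻ ∘ SignedSet-absUnique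

SignedSet-⊆⇒≡ : ∀ {k C D} → SignedSet k C → SignedSet k D → C ⊆ D → C ≡ D
SignedSet-⊆⇒≡ [] [] _ = refl
SignedSet-⊆⇒≡ {C = x ∷ C} {D = y ∷ D} (|x|≡1+k ∷ s) (|y|≡1+k ∷ t) x∷C⊆y∷D =
  cong₂ _∷_ x≡y (SignedSet-⊆⇒≡ s t C⊆D)
  where
  x≡y : x ≡ y
  x≡y with x∷C⊆y∷D (here refl)
  ... | here x≡y  = x≡y
  ... | there x∈D = contradiction x∈D (SignedSet-∉ t |x|≡1+k)
  C⊆D : C ⊆ D
  C⊆D z∈C with x∷C⊆y∷D (there z∈C)
  ... | here refl = contradiction z∈C (SignedSet-∉ s |y|≡1+k)
  ... | there z∈D = z∈D

entry-with-abs : ∀ {σ} → Unique (map absℤ σ) → ∀ k →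
                 ∃[ y ] ∣ y ∣ ≡ suc k × (∀ {x} → x ∈ σ → ∣ x ∣ ≡ suc k → x ≡ y)
entry-with-abs {σ} u k with -[1+ k ] ∈? σ
... | yes -k∈σ = -[1+ k ] , refl , λ x∈σ |x|≡1+k →
  map⁻-injectiveOn u x∈σ -k∈σ (cong +_ |x|≡1+k)
... | no  -k∉σ = + suc k , refl , λ {x} x∈σ |x|≡1+k →
  [ id , (λ { refl → contradiction x∈σ -k∉σ }) ] (∣∣≡suc⇒± {x} {k} |x|≡1+k)

SignedSet-cover : ∀ {σ} → Unique (map absℤ σ) → ∀ k →
                  ∃[ C ] SignedSet k C × (∀ {x} → x ∈ σ → x ∈ signedVals k → x ∈ C)
SignedSet-cover u zero = [] , [] , λ _ ()
SignedSet-cover u (suc k)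
  with C , s , covers ← SignedSet-cover u k | y , |y|≡1+k , y-unique ← entry-with-abs u k =
  y ∷ C , |y|≡1+k ∷ s ,
  λ x∈σ x∈ → [ there ∘ covers x∈σ , here ∘ y-unique x∈σ ] (∈-signedVals-suc⁻ x∈)

SignedSet-arrangement-↭ : ∀ {n C w} → SignedSet n C → w ∈ arrangements C n → w ↭ C
SignedSet-arrangement-↭ s = ∈-arrangements⇒↭ (SignedSet-unique s) (SignedSet-length s)

∈-Hyp⁻ : ∀ n {σ} → σ ∈ Hyp n → length σ ≡ n × σ ⊆ signedVals n × Unique (map absℤ σ)
∈-Hyp⁻ n σ∈
  with σ∈W , u ← ∈-filter⁻ (λ w → unique? (map absℤ w)) {xs = words (signedVals n) n} σ∈ =
  let |σ|≡n , σ⊆ = ∈-words⁻ (signedVals n) n σ∈W in |σ|≡n , σ⊆ , u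

∈-Hyp⁺ : ∀ {n σ} → length σ ≡ n → σ ⊆ signedVals n → Unique (map absℤ σ) → σ ∈ Hyp n
∈-Hyp⁺ {n} refl σ⊆ u = ∈-filter⁺ (λ w → unique? (map absℤ w)) (∈-words⁺ (signedVals n) σ⊆) u

Hyp↭concatMap-arrangements : ∀ n → Hyp n ↭ concatMap (λ C → arrangements C n) (signedSets n)
Hyp↭concatMap-arrangements n =
  unique∧⊆∧⊇⇒↭ (Unique.filter⁺ _ (words-unique (signedVals-unique n) n)) blocks-unique
               Hyp⊆blocks blocks⊆Hyp
  where
  blocks-unique : Unique (concatMap (λ C → arrangements C n) (signedSets n))
  blocks-unique = unique-concatMap (signedSets-unique n)
    (λ C∈ → arrangements-unique (SignedSet-unique (∈-signedSets⁻ n C∈)) n)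
    λ C∈ D∈ w∈C w∈D → SignedSet-⊆⇒≡ (∈-signedSets⁻ n C∈) (∈-signedSets⁻ n D∈)
      (∈-arrangements⇒⊆ n w∈D ∘ ∈-resp-↭ (↭-sym (SignedSet-arrangement-↭ (∈-signedSets⁻ n C∈) w∈C)))

  Hyp⊆blocks : Hyp n ⊆ concatMap (λ C → arrangements C n) (signedSets n)
  Hyp⊆blocks σ∈ with |σ|≡n , σ⊆ , u ← ∈-Hyp⁻ n σ∈ with C , s , covers ← SignedSet-cover u n =
    ∈-concat⁺′ (∈-arrangements⁺ |σ|≡n (λ x∈σ → covers x∈σ (σ⊆ x∈σ)) (Unique.map⁻ u))
               (∈-map⁺ _ (∈-signedSets⁺ s))

  blocks⊆Hyp : concatMap (λ C → arrangements C n) (signedSets n) ⊆ Hyp n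
  blocks⊆Hyp σ∈
    with C , C∈ , σ∈C* ← find (∈-concatMap⁻ (λ C → arrangements C n) {xs = signedSets n} σ∈)
    with |σ|≡n , σ⊆C , uσ ← ∈-arrangements⁻ n σ∈C* =
    let s = ∈-signedSets⁻ n C∈ in
    ∈-Hyp⁺ |σ|≡n (SignedSet-⊆ s ∘ σ⊆C)
      (map⁺-injectiveOn (injectiveOn-⊆ (map⁻-injectiveOn (SignedSet-absUnique s)) σ⊆C) uσ)

neg≡sum : ∀ w → neg w ≡ sum (map (λ x → if isNeg x then 1 else 0) w)
neg≡sum []      = refl
neg≡sum (x ∷ w) = cong (_ ℕ.+_) (neg≡sum w)

negSum≡sum : ∀ w → negSum w ≡ sum (map (λ x → if isNeg x then ∣ x ∣ else 0) w)
negSum≡sum []      = refl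
negSum≡sum (x ∷ w) = cong (_ ℕ.+_) (negSum≡sum w)

neg-↭ : ∀ {v w} → v ↭ w → neg v ≡ neg w
neg-↭ {v} {w} v↭w = trans (neg≡sum v) (trans (sum-↭ (↭-map⁺ _ v↭w)) (sym (neg≡sum w)))

negSum-↭ : ∀ {v w} → v ↭ w → negSum v ≡ negSum w
negSum-↭ {v} {w} v↭w =
  trans (negSum≡sum v) (trans (sum-↭ (↭-map⁺ _ v↭w)) (sym (negSum≡sum w)))

module WeightedSums {c ℓ} (R : CommutativeSemiring c ℓ) where
  open CommutativeSemiring R renaming (refl to ≈-refl; sym to ≈-sym; trans to ≈-trans)
  open Poly R
  open SetoidReasoning setoid
  open CommutativeSemigroupProperties *-commutativeSemigroup using (interchange)
  open ExpProperties R using (_^_; ^-homo-*; ^-distrib-*)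

  Σ[_]_ : ∀ {a} {X : Set a} → List X → (X → Carrier) → Carrier
  Σ[ xs ] f = sumL (map f xs)

  private
    variable
      a b : Level
      X : Set a
      Y : Set b

  Σ-++ : ∀ (f : X → Carrier) xs ys → Σ[ xs ++ ys ] f ≈ Σ[ xs ] f + Σ[ ys ] f
  Σ-++ f []       ys = ≈-sym (+-identityˡ _)
  Σ-++ f (x ∷ xs) ys = ≈-trans (+-congˡ (Σ-++ f xs ys)) (≈-sym (+-assoc _ _ _))

  Σ-concatMap : ∀ (f : Y → Carrier) (F : X → List Y) xs →
                Σ[ concatMap F xs ] f ≈ Σ[ xs ] (λ x → Σ[ F x ] f)
  Σ-concatMap f F []       = ≈-refl
  Σ-concatMap f F (x ∷ xs) =
    ≈-trans (Σ-++ f (F x) (concatMap F xs)) (+-congˡ (Σ-concatMap f F xs))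

  Σ-↭ : ∀ (f : X → Carrier) {xs ys} → xs ↭ ys → Σ[ xs ] f ≈ Σ[ ys ] f
  Σ-↭ f ↭.refl         = ≈-refl
  Σ-↭ f (↭.prep x p)   = +-congˡ (Σ-↭ f p)
  Σ-↭ f (↭.swap x y p) =
    ≈-trans (≈-sym (+-assoc _ _ _)) (≈-trans (+-cong (+-comm _ _) (Σ-↭ f p)) (+-assoc _ _ _))
  Σ-↭ f (↭.trans p q)  = ≈-trans (Σ-↭ f p) (Σ-↭ f q)

  Σ-cong : ∀ {f g : X → Carrier} {xs} → (∀ {x} → x ∈ xs → f x ≈ g x) →
           Σ[ xs ] f ≈ Σ[ xs ] g
  Σ-cong {xs = []}     _   = ≈-refl
  Σ-cong {xs = x ∷ xs} f≈g = +-cong (f≈g (here refl)) (Σ-cong (f≈g ∘ there))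

  Σ-map : ∀ (f : Y → Carrier) (g : X → Y) xs → Σ[ map g xs ] f ≡ Σ[ xs ] (f ∘ g)
  Σ-map f g xs = cong sumL (sym (List.map-∘ xs))

  Σ-*ˡ : ∀ (f : X → Carrier) xs c → c * Σ[ xs ] f ≈ Σ[ xs ] (λ x → c * f x)
  Σ-*ˡ f []       c = zeroʳ c
  Σ-*ˡ f (x ∷ xs) c = ≈-trans (distribˡ c _ _) (+-congˡ (Σ-*ˡ f xs c))

  Σ-*ʳ : ∀ (f : X → Carrier) xs c → Σ[ xs ] f * c ≈ Σ[ xs ] (λ x → f x * c)
  Σ-*ʳ f []       c = zeroˡ c
  Σ-*ʳ f (x ∷ xs) c = ≈-trans (distribʳ c _ _) (+-congˡ (Σ-*ʳ f xs c))

  pow≡^ : ∀ x n → pow x n ≡ x ^ n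
  pow≡^ x zero    = refl
  pow≡^ x (suc n) = cong (x *_) (pow≡^ x n)

  pow-homo-* : ∀ x m n → pow x (m ℕ.+ n) ≈ pow x m * pow x n
  pow-homo-* x m n rewrite pow≡^ x (m ℕ.+ n) | pow≡^ x m | pow≡^ x n = ^-homo-* x m n

  pow-distrib-* : ∀ x y n → pow (x * y) n ≈ pow x n * pow y n
  pow-distrib-* x y n rewrite pow≡^ (x * y) n | pow≡^ x n | pow≡^ y n = ^-distrib-* x y n

  pow-double : ∀ x m → pow x (2 ℕ.* m) ≈ pow (x * x) m
  pow-double x m = begin
    pow x (2 ℕ.* m)    ≡⟨ cong (pow x ∘ (m ℕ.+_)) (ℕ.+-identityʳ m) ⟩
    pow x (m ℕ.+ m)    ≈⟨ pow-homo-* x m m ⟩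
    pow x m * pow x m  ≈⟨ pow-distrib-* x x m ⟨
    pow (x * x) m      ∎

  majInvWeight : Carrier → Carrier → List ℤ → Carrier
  majInvWeight q t w = pow q (maj w) * pow t (inv w)

  signWeight : Carrier → Carrier → List ℤ → Carrier
  signWeight q t w = pow q (neg w) * pow t (negSum w)

  flagWeight : Carrier → Carrier → List ℤ → Carrier
  flagWeight q t w = pow q (flagMajor w) * pow t (lengthB w)

  flagWeight-split : ∀ q t w → flagWeight q t w ≈ majInvWeight (q * q) t w * signWeight q t w
  flagWeight-split q t w = begin
    pow q (2 ℕ.* maj w ℕ.+ neg w) * pow t (inv w ℕ.+ negSum w)
      ≈⟨ *-cong (pow-homo-* q (2 ℕ.* maj w) (neg w)) (pow-homo-* t (inv w) (negSum w)) ⟩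
    (pow q (2 ℕ.* maj w) * pow q (neg w)) * (pow t (inv w) * pow t (negSum w))
      ≈⟨ *-congʳ (*-congʳ (pow-double q (maj w))) ⟩
    (pow (q * q) (maj w) * pow q (neg w)) * (pow t (inv w) * pow t (negSum w))
      ≈⟨ interchange _ _ _ _ ⟩
    majInvWeight (q * q) t w * signWeight q t w
      ∎

  signWeight-↭ : ∀ q t {v w} → v ↭ w → signWeight q t v ≡ signWeight q t w
  signWeight-↭ q t v↭w = cong₂ (λ m n → pow q m * pow t n) (neg-↭ v↭w) (negSum-↭ v↭w)

  signWeight-negate : ∀ q t k C →
                      signWeight q t (-[1+ k ] ∷ C) ≈ signWeight q t C * (q * pow t (suc k))
  signWeight-negate q t k C = begin
    (q * pow q (neg C)) * pow t (suc k ℕ.+ negSum C)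
      ≈⟨ *-congˡ (pow-homo-* t (suc k) (negSum C)) ⟩
    (q * pow q (neg C)) * (pow t (suc k) * pow t (negSum C))
      ≈⟨ interchange _ _ _ _ ⟩
    (q * pow t (suc k)) * signWeight q t C
      ≈⟨ *-comm _ _ ⟩
    signWeight q t C * (q * pow t (suc k))
      ∎

  Σ-signedSets : ∀ q t k → Σ[ signedSets k ] signWeight q t ≈ prodFactor k q t
  Σ-signedSets q t zero    = ≈-trans (+-identityʳ _) (*-identityˡ 1#)
  Σ-signedSets q t (suc k) = begin
    Σ[ map (+ suc k ∷_) S ++ map (-[1+ k ] ∷_) S ] w
      ≈⟨ Σ-++ w (map (+ suc k ∷_) S) (map (-[1+ k ] ∷_) S) ⟩
    Σ[ map (+ suc k ∷_) S ] w + Σ[ map (-[1+ k ] ∷_) S ] w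
      ≡⟨ cong₂ _+_ (Σ-map w (+ suc k ∷_) S) (Σ-map w (-[1+ k ] ∷_) S) ⟩
    Σ[ S ] w + Σ[ S ] (λ C → w (-[1+ k ] ∷ C))
      ≈⟨ +-cong (≈-sym (*-identityʳ _)) (Σ-cong {xs = S} λ {C} _ → signWeight-negate q t k C) ⟩
    Σ[ S ] w * 1# + Σ[ S ] (λ C → w C * x)
      ≈⟨ +-congˡ (Σ-*ʳ w S x) ⟨
    Σ[ S ] w * 1# + Σ[ S ] w * x
      ≈⟨ distribˡ _ _ _ ⟨
    Σ[ S ] w * (1# + x)
      ≈⟨ *-congʳ (Σ-signedSets q t k) ⟩
    prodFactor k q t * (1# + x)
      ∎
    where
    S = signedSets k
    w = signWeight q t
    x = q * pow t (suc k)

  majInvWeight-map : ∀ Q t {f A w} → StrictlyMonotoneOn f A → w ⊆ A →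
                     majInvWeight Q t (map f w) ≡ majInvWeight Q t w
  majInvWeight-map Q t mono w⊆A =
    cong₂ (λ m i → pow Q m * pow t i) (majFrom-map mono 1 w⊆A) (inv-map mono w⊆A)

  Σ-arrangements-majInv : ∀ Q t {C} → Unique C →
                          Σ[ arrangements C (length C) ] majInvWeight Q t ≈ A (length C) Q t
  Σ-arrangements-majInv Q t {C} uC = begin
    Σ[ arrangements C n ] majInvWeight Q t
      ≈⟨ Σ-cong {xs = arrangements C n} (λ w∈ → reflexive
           (majInvWeight-map Q t (rank-strictlyMonotoneOn C) (∈-arrangements⇒⊆ n w∈))) ⟨
    Σ[ arrangements C n ] (majInvWeight Q t ∘ map (rank C))
      ≡⟨ Σ-map (majInvWeight Q t) (map (rank C)) (arrangements C n) ⟨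
    Σ[ map (map (rank C)) (arrangements C n) ] majInvWeight Q t
      ≈⟨ Σ-↭ (majInvWeight Q t) (arrangements-standardise uC) ⟩
    Σ[ Sym n ] majInvWeight Q t
      ∎
    where
    n = length C

  Σ-arrangements-flagWeight : ∀ q t {n C} → SignedSet n C →
                              Σ[ arrangements C n ] flagWeight q t
                                ≈ A n (q * q) t * signWeight q t C
  Σ-arrangements-flagWeight q t {C = C} s with refl ← SignedSet-length s = begin
    Σ[ arrangements C n ] flagWeight q t
      ≈⟨ Σ-cong (λ {w} w∈ → ≈-trans (flagWeight-split q t w)
           (*-congˡ (reflexive (signWeight-↭ q t (SignedSet-arrangement-↭ s w∈))))) ⟩
    Σ[ arrangements C n ] (λ w → majInvWeight (q * q) t w * signWeight q t C)
      ≈⟨ Σ-*ʳ (majInvWeight (q * q) t) (arrangements C n) (signWeight q t C) ⟨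
    Σ[ arrangements C n ] majInvWeight (q * q) t * signWeight q t C
      ≈⟨ *-congʳ (Σ-arrangements-majInv (q * q) t (SignedSet-unique s)) ⟩
    A n (q * q) t * signWeight q t C
      ∎
    where
    n = length C

mainTheorem5 : ∀ {c ℓ : Level} (R : CommutativeSemiring c ℓ) (n : ℕ) → n ≥ 1 →
    ∀ (q t : CommutativeSemiring.Carrier R) →
      CommutativeSemiring._≈_ R (Poly.B R n q t)
        (CommutativeSemiring._*_ R (Poly.A R n (CommutativeSemiring._*_ R q q) t) (Poly.prodFactor R n q t))
-- The identity also holds for n = 0.
mainTheorem5 R n _ q t = begin
  B n q t
    ≈⟨ Σ-↭ (flagWeight q t) (Hyp↭concatMap-arrangements n) ⟩
  Σ[ concatMap (λ C → arrangements C n) (signedSets n) ] flagWeight q t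
    ≈⟨ Σ-concatMap (flagWeight q t) (λ C → arrangements C n) (signedSets n) ⟩
  Σ[ signedSets n ] (λ C → Σ[ arrangements C n ] flagWeight q t)
    ≈⟨ Σ-cong (λ C∈ → Σ-arrangements-flagWeight q t (∈-signedSets⁻ n C∈)) ⟩
  Σ[ signedSets n ] (λ C → A n (q * q) t * signWeight q t C)
    ≈⟨ Σ-*ˡ (signWeight q t) (signedSets n) (A n (q * q) t) ⟨
  A n (q * q) t * Σ[ signedSets n ] signWeight q t
    ≈⟨ *-congˡ (Σ-signedSets q t n) ⟩
  A n (q * q) t * prodFactor n q t
    ∎
  where
  open CommutativeSemiring R
  open Poly R
  open WeightedSums R
  open SetoidReasoning setoid
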